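{- Let $w : [n] \to \mathbb{N}$ be an item weight function and $l = 1 + \lceil \log(\max_i w(i)) \rceil$. Then for all $s \in [l]$: \[ \frac{1}{3n} |w_s(2^{[n]})| \le |w_{s-1}(2^{[n]})| \le \frac{3n}{2} |w_s(2^{[n]})|. \]
   Context: For $s \in \{0,\ldots,l\}$ the $s$-pruned weight of item $i$ is $w_s(i) := \lfloor w(i)/2^{l-s} \rfloor$, and $w_s(X) := \sum_{i \in X} w_s(i)$ for $X \subseteq [n]$; $w_s(2^{[n]}) := \{ w_s(X) : X \subseteq [n]\}$. Logarithms are base 2. -}

module Defs where

open import Data.Nat using (ℕ; zero; suc; _+_; _∸_; _^_; _⊔_; _≟_)
open import Data.Nat.DivMod using (_/_)
open import Data.Nat.Logarithm using (⌈log₂_⌉)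
open import Data.Bool using (Bool; true; false; if_then_else_)
open import Data.Fin using (Fin)
open import Data.Fin.Subset using (Subset; inside; outside)
open import Data.Vec using (Vec; []; _∷_; lookup)
open import Data.List using (List; []; _∷_; _++_; map; length; deduplicate; allFin)
open import Data.Nat.ListAction using (sum)
open import Data.Nat.Properties using (m^n≢0)

Weights : ℕ → Set
Weights n = Fin n → ℕ

maxW : ∀ {n} → Weights n → ℕ
maxW {n} w = Data.List.foldr _⊔_ 0 (map w (allFin n))

-- l = 1 + ⌈log₂ (max_i w(i))⌉   (stdlib convention ⌈log₂ 0⌉ = 0)
ell : ∀ {n} → Weights n → ℕ
ell w = 1 + ⌈log₂ maxW w ⌉

pruned : ∀ {n} → Weights n → ℕ → Weights n
pruned w s i = _/_ (w i) (2 ^ (ell w ∸ s)) {{m^n≢0 2 (ell w ∸ s)}}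

subsetWeight : ∀ {n} → Weights n → Subset n → ℕ
subsetWeight {n} w X = sum (map (λ i → if lookup X i then w i else 0) (allFin n))

allSubsets : (n : ℕ) → List (Subset n)
allSubsets zero = [] ∷ []
allSubsets (suc n) = map (outside ∷_) (allSubsets n) ++ map (inside ∷_) (allSubsets n)

numSubsetSums : ∀ {n} → Weights n → ℕ
numSubsetSums {n} w = length (deduplicate _≟_ (map (subsetWeight w) (allSubsets n)))

-- Pruning one level more halves every item weight, so w_s(X) = 2 w_{s-1}(X) + r(X), where r(X) ≤ n
-- counts the items of X whose s-pruned weight is odd.  Hence every value of w_s lies in a window of
-- n + 1 integers above 2 w_{s-1}(X), and every value of w_{s-1} lies in a window of ⌊n/2⌋ + 1 integers
-- below ⌊w_s(X)/2⌋.  Covering one set of subset sums by windows attached to the other bounds each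
-- count by the window size times the other count; both window sizes are at most 3n, resp. 3n/2.
module Submission where

open import Defs
open import Data.Nat using (ℕ; _*_; _≤_; _∸_)
open import Data.Product using (_×_)

open import Data.Nat using (suc; _+_; _^_; z≤n; s≤s; s≤s⁻¹; _≟_; _%_; _/_)
open import Data.Nat.Properties
open import Algebra.Properties.CommutativeSemigroup +-commutativeSemigroup
  using () renaming (interchange to +-interchange)
open import Data.Nat.DivMod
open import Data.Nat.Divisibility using (divides-refl)
open import Data.Nat.ListAction using (sum)
open import Data.Product using (_,_; proj₁; proj₂)
open import Data.Bool using (true; false; if_then_else_)
open import Data.Fin.Subset using (Subset)
open import Data.Vec using (lookup)
open import Data.List using (List; []; _∷_; map; length; deduplicate; allFin; concatMap; applyUpTo)
open import Data.List.Properties using (length-removeAt′; length-++; length-applyUpTo; length-tabulate; map-cong)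
open import Data.List.Membership.Propositional using (_∈_; _─_)
open import Data.List.Membership.Propositional.Properties
  using (∈-map⁺; ∈-map⁻; ∈-concat⁺′; ∈-deduplicate⁺; ∈-deduplicate⁻; ∈-applyUpTo⁺)
open import Data.List.Relation.Unary.Any using (here; there)
import Data.List.Relation.Unary.All as All
open import Data.List.Relation.Unary.AllPairs using (_∷_)
open import Data.List.Relation.Unary.Unique.Propositional using (Unique)
open import Data.List.Relation.Unary.Unique.DecPropositional.Properties using (deduplicate-!)
open import Data.Empty using (⊥-elim)
open import Relation.Binary.Definitions using (DecidableEquality)
open import Relation.Binary.PropositionalEquality
open import Relation.Nullary using (¬_)
open import Function using (_∘_)

∈-─ : ∀ {A : Set} {x z : A} (ys : List A) (x∈ys : x ∈ ys) → z ∈ ys → ¬ x ≡ z → z ∈ ys ─ x∈ys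
∈-─ (y ∷ ys) (here refl) (here refl) x≢z = ⊥-elim (x≢z refl)
∈-─ (y ∷ ys) (here _)    (there z∈ys) _   = z∈ys
∈-─ (y ∷ ys) (there _)   (here z≡y)   _   = here z≡y
∈-─ (y ∷ ys) (there x∈ys) (there z∈ys) x≢z = there (∈-─ ys x∈ys z∈ys x≢z)

Unique-⊆⇒length-≤ : ∀ {A : Set} {xs ys : List A} → Unique xs → (∀ {z} → z ∈ xs → z ∈ ys) →
  length xs ≤ length ys
Unique-⊆⇒length-≤ {xs = []} _ _ = z≤n
Unique-⊆⇒length-≤ {xs = x ∷ xs} {ys} (x∉xs ∷ xs!) xs⊆ys =
  subst (suc (length xs) ≤_) (sym (length-removeAt′ ys _))
    (s≤s (Unique-⊆⇒length-≤ xs! λ z∈xs → ∈-─ ys x∈ys (xs⊆ys (there z∈xs)) (All.lookup x∉xs z∈xs)))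
  where x∈ys = xs⊆ys (here refl)

length-concatMap-≤ : ∀ {A B : Set} (h : B → List A) {c} → (∀ y → length (h y) ≤ c) →
  ∀ ys → length (concatMap h ys) ≤ c * length ys
length-concatMap-≤ h {c} _ [] = ≤-reflexive (sym (*-zeroʳ c))
length-concatMap-≤ h {c} |h|≤c (y ∷ ys) = begin
  length (concatMap h (y ∷ ys))           ≡⟨ length-++ (h y) ⟩
  length (h y) + length (concatMap h ys) ≤⟨ +-mono-≤ (|h|≤c y) (length-concatMap-≤ h |h|≤c ys) ⟩
  c + c * length ys                      ≡⟨ *-suc c (length ys) ⟨
  c * suc (length ys)                    ∎
  where open ≤-Reasoning

length-deduplicate-map-≤ : ∀ {A B I : Set} (_≟ᴬ_ : DecidableEquality A) (_≟ᴮ_ : DecidableEquality B)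
  (f : I → A) (g : I → B) (h : B → List A) {c} → (∀ y → length (h y) ≤ c) →
  (∀ i → f i ∈ h (g i)) → ∀ is →
  length (deduplicate _≟ᴬ_ (map f is)) ≤ c * length (deduplicate _≟ᴮ_ (map g is))
length-deduplicate-map-≤ _≟ᴬ_ _≟ᴮ_ f g h |h|≤c f∈hg is =
  ≤-trans (Unique-⊆⇒length-≤ (deduplicate-! _≟ᴬ_ (map f is)) covered)
          (length-concatMap-≤ h |h|≤c (deduplicate _≟ᴮ_ (map g is)))
  where
  covered : ∀ {x} → x ∈ deduplicate _≟ᴬ_ (map f is) → x ∈ concatMap h (deduplicate _≟ᴮ_ (map g is))
  covered x∈ with ∈-map⁻ f (∈-deduplicate⁻ _≟ᴬ_ (map f is) x∈)
  ... | i , i∈is , refl =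
    ∈-concat⁺′ (f∈hg i) (∈-map⁺ h (∈-deduplicate⁺ _≟ᴮ_ (∈-map⁺ g i∈is)))

interval : ℕ → ℕ → List ℕ
interval a d = applyUpTo (a +_) (suc d)

length-interval : ∀ a d → length (interval a d) ≡ suc d
length-interval a d = length-applyUpTo (a +_) (suc d)

∈-interval : ∀ {a b d} → a ≤ b → b ≤ a + d → b ∈ interval a d
∈-interval {a} {b} a≤b b≤a+d =
  subst (_∈ interval a _) (m+[n∸m]≡n a≤b) (∈-applyUpTo⁺ (a +_) (s≤s (m≤n+o⇒m∸n≤o b a b≤a+d)))

numSubsetSums-≤-window : ∀ {n} (u v : Weights n) (lo : ℕ → ℕ) d →
  (∀ X → lo (subsetWeight v X) ≤ subsetWeight u X) →
  (∀ X → subsetWeight u X ≤ lo (subsetWeight v X) + d) →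
  numSubsetSums u ≤ suc d * numSubsetSums v
numSubsetSums-≤-window {n} u v lo d lo≤u u≤lo+d =
  length-deduplicate-map-≤ _≟_ _≟_ (subsetWeight u) (subsetWeight v) (λ y → interval (lo y) d)
    (λ y → ≤-reflexive (length-interval (lo y) d))
    (λ X → ∈-interval (lo≤u X) (u≤lo+d X)) (allSubsets n)

sum-map-+ : ∀ {A : Set} (f g : A → ℕ) xs →
  sum (map (λ x → f x + g x) xs) ≡ sum (map f xs) + sum (map g xs)
sum-map-+ f g [] = refl
sum-map-+ f g (x ∷ xs) =
  trans (cong (f x + g x +_) (sum-map-+ f g xs)) (+-interchange (f x) (g x) _ _)

sum-map-*ˡ : ∀ {A : Set} k (f : A → ℕ) xs → sum (map (λ x → k * f x) xs) ≡ k * sum (map f xs)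
sum-map-*ˡ k f [] = sym (*-zeroʳ k)
sum-map-*ˡ k f (x ∷ xs) =
  trans (cong (k * f x +_) (sum-map-*ˡ k f xs)) (sym (*-distribˡ-+ k (f x) _))

sum-map-≤ : ∀ {A : Set} (f : A → ℕ) {c} → (∀ x → f x ≤ c) → ∀ xs → sum (map f xs) ≤ c * length xs
sum-map-≤ f {c} _ [] = ≤-reflexive (sym (*-zeroʳ c))
sum-map-≤ f {c} f≤c (x ∷ xs) =
  ≤-trans (+-mono-≤ (f≤c x) (sum-map-≤ f f≤c xs)) (≤-reflexive (sym (*-suc c (length xs))))

masked : ∀ {n} → Subset n → Weights n → Weights n
masked X u i = if lookup X i then u i else 0

subsetWeight-linear : ∀ {n} k (u v r : Weights n) → (∀ i → u i ≡ k * v i + r i) →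
  ∀ X → subsetWeight u X ≡ k * subsetWeight v X + subsetWeight r X
subsetWeight-linear {n} k u v r u≡kv+r X = begin
  sum (map (masked X u) (allFin n))
    ≡⟨ cong sum (map-cong masked-linear (allFin n)) ⟩
  sum (map (λ i → k * masked X v i + masked X r i) (allFin n))
    ≡⟨ sum-map-+ _ _ (allFin n) ⟩
  sum (map (λ i → k * masked X v i) (allFin n)) + subsetWeight r X
    ≡⟨ cong (_+ _) (sum-map-*ˡ k _ (allFin n)) ⟩
  k * subsetWeight v X + subsetWeight r X ∎
  where
  open ≡-Reasoning
  masked-linear : ∀ i → masked X u i ≡ k * masked X v i + masked X r i
  masked-linear i with lookup X i
  ... | true  = u≡kv+r i
  ... | false = sym (trans (+-identityʳ (k * 0)) (*-zeroʳ k))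

subsetWeight-≤ : ∀ {n} (u : Weights n) {c} → (∀ i → u i ≤ c) → ∀ X → subsetWeight u X ≤ c * n
subsetWeight-≤ {n} u {c} u≤c X =
  subst (λ m → subsetWeight u X ≤ c * m) (length-tabulate (λ i → i))
    (sum-map-≤ (masked X u) masked≤c (allFin n))
  where
  masked≤c : ∀ i → masked X u i ≤ c
  masked≤c i with lookup X i
  ... | true  = u≤c i
  ... | false = z≤n

m≡2*[m/2]+m%2 : ∀ m → m ≡ 2 * (m / 2) + m % 2
m≡2*[m/2]+m%2 m =
  trans (m≡m%n+[m/n]*n m 2) (trans (+-comm (m % 2) _) (cong (_+ m % 2) (*-comm (m / 2) 2)))

subsetWeight-halves : ∀ {n} (u v : Weights n) → (∀ i → v i ≡ u i / 2) →
  ∀ X → 2 * subsetWeight v X ≤ subsetWeight u X × subsetWeight u X ≤ 2 * subsetWeight v X + n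
subsetWeight-halves {n} u v v≡u/2 X =
  subst (λ t → 2 * subsetWeight v X ≤ t × t ≤ 2 * subsetWeight v X + n) (sym u≡2v+r)
    (m≤m+n _ _ , +-monoʳ-≤ _ r≤n)
  where
  r : Weights n
  r i = u i % 2
  u≡2v+r : subsetWeight u X ≡ 2 * subsetWeight v X + subsetWeight r X
  u≡2v+r = subsetWeight-linear 2 u v r
    (λ i → trans (m≡2*[m/2]+m%2 (u i)) (cong (λ t → 2 * t + u i % 2) (sym (v≡u/2 i)))) X
  r≤n : subsetWeight r X ≤ n
  r≤n = subst (subsetWeight r X ≤_) (*-identityˡ n)
          (subsetWeight-≤ r (λ i → s≤s⁻¹ (m%n<n (u i) 2)) X)

module _ (k : ℕ) where
  private instance
    2^k≢0   = m^n≢0 2 k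
    2^1+k≢0 = m^n≢0 2 (suc k)
    2^k*2≢0 = m*n≢0 (2 ^ k) 2

  m/2^[1+k]≡m/2^k/2 : ∀ m → m / 2 ^ suc k ≡ m / 2 ^ k / 2
  m/2^[1+k]≡m/2^k/2 m = trans (/-congʳ (*-comm 2 (2 ^ k))) (sym (m/n/o≡m/[n*o] m (2 ^ k) 2))

pruned-halves : ∀ {n} (w : Weights n) {s} → suc s ≤ ell w → ∀ i → pruned w s i ≡ pruned w (suc s) i / 2
pruned-halves w {s} s<ell i rewrite +-∸-assoc 1 s<ell = m/2^[1+k]≡m/2^k/2 (ell w ∸ suc s) (w i)

halving-window : ∀ {a b d} → 2 * a ≤ b → b ≤ 2 * a + d →
  b / 2 ∸ d / 2 ≤ a × a ≤ b / 2 ∸ d / 2 + d / 2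
halving-window {a} {b} {d} 2a≤b b≤2a+d = m≤n+o⇒m∸n≤o (b / 2) (d / 2) b/2≤d/2+a , a≤b/2∸d/2+d/2
  where
  open ≤-Reasoning
  b/2≤d/2+a : b / 2 ≤ d / 2 + a
  b/2≤d/2+a = begin
    b / 2             ≤⟨ /-monoˡ-≤ 2 (subst (b ≤_) (cong (_+ d) (*-comm 2 a)) b≤2a+d) ⟩
    (a * 2 + d) / 2   ≡⟨ +-distrib-/-∣ˡ d (divides-refl a) ⟩
    a * 2 / 2 + d / 2 ≡⟨ cong (_+ d / 2) (m*n/n≡m a 2) ⟩
    a + d / 2         ≡⟨ +-comm a (d / 2) ⟩
    d / 2 + a         ∎
  a≤b/2∸d/2+d/2 : a ≤ b / 2 ∸ d / 2 + d / 2
  a≤b/2∸d/2+d/2 = begin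
    a                     ≡⟨ m*n/n≡m a 2 ⟨
    a * 2 / 2             ≤⟨ /-monoˡ-≤ 2 (subst (_≤ b) (*-comm 2 a) 2a≤b) ⟩
    b / 2                 ≤⟨ m≤n+m∸n (b / 2) (d / 2) ⟩
    d / 2 + (b / 2 ∸ d / 2) ≡⟨ +-comm (d / 2) _ ⟩
    b / 2 ∸ d / 2 + d / 2 ∎

1+n≤3*n : ∀ {n} → 1 ≤ n → suc n ≤ 3 * n
1+n≤3*n {n} 1≤n = ≤-trans (+-monoˡ-≤ n 1≤n) (+-monoʳ-≤ n (m≤m+n n (n + 0)))

2*[1+n/2]≤3*n : ∀ {n} → 1 ≤ n → 2 * suc (n / 2) ≤ 3 * n
2*[1+n/2]≤3*n {n} 1≤n = begin
  2 * suc (n / 2)  ≡⟨ *-suc 2 (n / 2) ⟩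
  2 + 2 * (n / 2)  ≤⟨ +-monoʳ-≤ 2 (subst (_≤ n) (*-comm (n / 2) 2) (m/n*n≤m n 2)) ⟩
  2 + n            ≤⟨ +-monoˡ-≤ n (*-monoʳ-≤ 2 1≤n) ⟩
  2 * n + n        ≡⟨ +-comm (2 * n) n ⟩
  3 * n            ∎
  where open ≤-Reasoning

lemma3p3 : (n : ℕ) → 1 ≤ n → (w : Weights n) → (s : ℕ) → 1 ≤ s → s ≤ ell w →
    (numSubsetSums (pruned w s) ≤ (3 * n) * numSubsetSums (pruned w (s ∸ 1)))
    × (2 * numSubsetSums (pruned w (s ∸ 1)) ≤ (3 * n) * numSubsetSums (pruned w s))
lemma3p3 n 1≤n w (suc s) _ s<ell = fine-count , coarse-count
  where
  fine coarse : Subset n → ℕ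
  fine   = subsetWeight (pruned w (suc s))
  coarse = subsetWeight (pruned w s)

  doubling : ∀ X → 2 * coarse X ≤ fine X × fine X ≤ 2 * coarse X + n
  doubling = subsetWeight-halves (pruned w (suc s)) (pruned w s) (pruned-halves w s<ell)

  halving : ∀ X → fine X / 2 ∸ n / 2 ≤ coarse X × coarse X ≤ fine X / 2 ∸ n / 2 + n / 2
  halving X = halving-window (proj₁ (doubling X)) (proj₂ (doubling X))

  fine-count : numSubsetSums (pruned w (suc s)) ≤ 3 * n * numSubsetSums (pruned w s)
  fine-count = ≤-trans
    (numSubsetSums-≤-window _ _ (2 *_) n (proj₁ ∘ doubling) (proj₂ ∘ doubling))
    (*-monoˡ-≤ _ (1+n≤3*n 1≤n))

  coarse-count : 2 * numSubsetSums (pruned w s) ≤ 3 * n * numSubsetSums (pruned w (suc s))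
  coarse-count = begin
    2 * numSubsetSums (pruned w s)
      ≤⟨ *-monoʳ-≤ 2 (numSubsetSums-≤-window _ _ (λ y → y / 2 ∸ n / 2) (n / 2)
                        (proj₁ ∘ halving) (proj₂ ∘ halving)) ⟩
    2 * (suc (n / 2) * numSubsetSums (pruned w (suc s)))
      ≡⟨ *-assoc 2 (suc (n / 2)) _ ⟨
    2 * suc (n / 2) * numSubsetSums (pruned w (suc s))
      ≤⟨ *-monoˡ-≤ _ (2*[1+n/2]≤3*n 1≤n) ⟩
    3 * n * numSubsetSums (pruned w (suc s)) ∎
    where open ≤-Reasoning
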